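{- Let $\mathbb{k}$ be a field of characteristic zero, $A$ a commutative unital $\mathbb{k}$-algebra and $B$ a commutative unital $\mathbb{k}$-algebra which is an integral domain. If a $\mathbb{k}$-linear map $f : A \to B$ satisfies $\Phi_{n+1}(f) \equiv 0$, then $f(1) = k\cdot 1_B$ for some $k \in \{0,1,2,\dots,n\}$.
   Context: For a $\mathbb{k}$-linear map $f : A \to B$ and $m \ge 1$, define $\Phi_m(f)(a_1,\dots,a_m) = \sum_{\sigma \in \Sigma_m} \epsilon(\sigma) f_\sigma(a_1,\dots,a_m)$, where $\epsilon(\sigma)$ is the sign, and if $\sigma = \gamma_1\cdots\gamma_q$ is the disjoint cycle decomposition (including cycles of length one) then $f_\sigma = \prod_j f_{\gamma_j}$ with $f_\gamma(a_1,\dots,a_m) = f(a_{r_1}\cdots a_{r_j})$ for $\gamma = (r_1\,\dots\,r_j)$. $\Phi_m(f)\equiv 0$ means $\Phi_m(f)$ vanishes identically. -}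

module Defs where

open import Level using (Level; _⊔_) renaming (suc to lsuc)
open import Data.Nat as ℕ using (ℕ; zero; suc; _<ᵇ_; _≤ᵇ_)
open import Data.Bool using (Bool; true; false; not; _∨_; _∧_; if_then_else_; T?)
open import Data.Fin as Fin using (Fin; toℕ)
open import Data.List using (List; []; _∷_; map; concatMap; foldr; filter; length)
open import Data.Bool.ListAction using (all; any)
open import Data.List.Base using (allFin)
open import Data.Product using (Σ; _×_; _,_)
open import Data.Sum using (_⊎_)
open import Relation.Nullary using (¬_)
open import Relation.Nullary.Decidable using (⌊_⌋)
open import Algebra.Bundles using (CommutativeRing)
open import Algebra.Morphism.Structures using (IsRingHomomorphism)
import Algebra.Definitions.RawMonoid as RM

record IsField {c ℓ} (R : CommutativeRing c ℓ) : Set (c ⊔ ℓ) where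
  open CommutativeRing R
  field
    nontrivial : ¬ (1# ≈ 0#)
    inverse    : ∀ x → ¬ (x ≈ 0#) → Σ Carrier λ y → x * y ≈ 1#

natCast : ∀ {c ℓ} (R : CommutativeRing c ℓ) → ℕ → CommutativeRing.Carrier R
natCast R n = n ×ₘ 1#
  where open CommutativeRing R
        open RM +-rawMonoid using () renaming (_×_ to _×ₘ_)

CharZero : ∀ {c ℓ} (R : CommutativeRing c ℓ) → Set ℓ
CharZero R = ∀ n → ¬ (natCast R (suc n) ≈ 0#)
  where open CommutativeRing R

record IsIntegralDomain {c ℓ} (R : CommutativeRing c ℓ) : Set (c ⊔ ℓ) where
  open CommutativeRing R
  field
    nontrivial      : ¬ (1# ≈ 0#)
    noZeroDivisors  : ∀ x y → x * y ≈ 0# → (x ≈ 0#) ⊎ (y ≈ 0#)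

record Algebra {c ℓ} (K : CommutativeRing c ℓ) (c' ℓ' : Level)
       : Set (c ⊔ ℓ ⊔ lsuc (c' ⊔ ℓ')) where
  field
    ringA : CommutativeRing c' ℓ'
    alg   : CommutativeRing.Carrier K → CommutativeRing.Carrier ringA
    isHom : IsRingHomomorphism (CommutativeRing.rawRing K)
                               (CommutativeRing.rawRing ringA) alg
  open CommutativeRing ringA public
  _·_ : CommutativeRing.Carrier K → Carrier → Carrier
  x · a = alg x * a

record IsLinear {c ℓ c₁ ℓ₁ c₂ ℓ₂} {K : CommutativeRing c ℓ}
       (A : Algebra K c₁ ℓ₁) (B : Algebra K c₂ ℓ₂)
       (f : Algebra.Carrier A → Algebra.Carrier B)
       : Set (c ⊔ c₁ ⊔ ℓ₁ ⊔ c₂ ⊔ ℓ₂) where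
  module A = Algebra A
  module B = Algebra B
  field
    cong  : ∀ {x y} → x A.≈ y → f x B.≈ f y
    +-hom : ∀ x y → f (x A.+ y) B.≈ f x B.+ f y
    ·-hom : ∀ (x : CommutativeRing.Carrier K) a → f (x A.· a) B.≈ x B.· f a

-- Permutations of Fin m, represented as functions Fin m → Fin m that are
-- injective (hence bijective).

_==_ : ∀ {m} → Fin m → Fin m → Bool
i == j = ⌊ i Fin.≟ j ⌋

allFuns : ∀ m n → List (Fin m → Fin n)
allFuns zero    n = (λ ()) ∷ []
allFuns (suc m) n =
  concatMap (λ g → map (λ j → λ { Fin.zero → j ; (Fin.suc i) → g i }) (allFin n))
            (allFuns m n)

isPerm : ∀ {m} → (Fin m → Fin m) → Bool
isPerm {m} σ = all (λ i → all (λ j → (i == j) ∨ not (σ i == σ j)) (allFin m)) (allFin m)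

perms : ∀ m → List (Fin m → Fin m)
perms m = filter (λ σ → T? (isPerm σ)) (allFuns m m)

inversions : ∀ {m} → (Fin m → Fin m) → ℕ
inversions {m} σ =
  length (filter (λ p → T? (inv p))
                 (concatMap (λ i → map (λ j → (i , j)) (allFin m)) (allFin m)))
  where
  inv : Fin m × Fin m → Bool
  inv (i , j) = (toℕ i <ᵇ toℕ j) ∧ (toℕ (σ j) <ᵇ toℕ (σ i))

even : ℕ → Bool
even zero          = true
even (suc zero)    = false
even (suc (suc n)) = even n

signEven : ∀ {m} → (Fin m → Fin m) → Bool
signEven σ = even (inversions σ)

iter : ∀ {m} → (Fin m → Fin m) → ℕ → Fin m → Fin m
iter σ zero    i = i
iter σ (suc t) i = σ (iter σ t i)

inCycle : ∀ {m} → (Fin m → Fin m) → Fin m → Fin m → Bool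
inCycle {m} σ i j = any (λ t → iter σ (toℕ t) i == j) (allFin m)

-- i is the designated representative (the least element) of its cycle;
-- the cycles of σ (including fixed points) correspond bijectively to
-- their least elements.
isLeader : ∀ {m} → (Fin m → Fin m) → Fin m → Bool
isLeader {m} σ i = all (λ j → not (inCycle σ i j) ∨ (toℕ i ≤ᵇ toℕ j)) (allFin m)

module _ {c ℓ c₁ ℓ₁ c₂ ℓ₂} {K : CommutativeRing c ℓ}
         (A : Algebra K c₁ ℓ₁) (B : Algebra K c₂ ℓ₂) where
  private
    module A = Algebra A
    module B = Algebra B

  fCycle : ∀ {m} → (A.Carrier → B.Carrier) → (Fin m → Fin m)
         → Fin m → (Fin m → A.Carrier) → B.Carrier
  fCycle {m} f σ i a =
    f (foldr (λ j r → if inCycle σ i j then a j A.* r else r) A.1# (allFin m))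

  fPerm : ∀ {m} → (A.Carrier → B.Carrier) → (Fin m → Fin m)
        → (Fin m → A.Carrier) → B.Carrier
  fPerm {m} f σ a =
    foldr (λ i r → if isLeader σ i then fCycle f σ i a B.* r else r) B.1# (allFin m)

  Φ : ∀ m → (A.Carrier → B.Carrier) → (Fin m → A.Carrier) → B.Carrier
  Φ m f a =
    foldr (λ σ r → (if signEven σ then fPerm f σ a else B.- fPerm f σ a) B.+ r)
          B.0# (perms m)

-- Evaluating Φ_m(f) at a₁ = ⋯ = a_m = 1 gives the signed cycle sum Σ_σ ε(σ) c^(cycles of σ) with
-- c = f(1), and this sum is the falling factorial c (c − 1) ⋯ (c − m + 1). Indeed every permutation
-- of {0,…,m} arises exactly once from a permutation τ of {0,…,m−1} by sending the new point m
-- either to itself (one more cycle, same sign) or into the cycle of some p, between p and τ p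
-- (same cycles, opposite sign); so passing from m to m + 1 multiplies the sum by c − m. In an
-- integral domain, c (c − 1) ⋯ (c − n) = 0 forces c = k · 1 for some k ≤ n.
module Submission where

open import Defs
open import Data.Nat using (ℕ; suc; _≤_)
open import Data.Product using (Σ; _×_)
open import Data.Fin using (Fin)
open import Algebra.Bundles using (CommutativeRing)

open import Algebra.Bundles using (CommutativeMonoid)
open import Data.Bool using (Bool; true; false; not; _∨_; _∧_; if_then_else_; T; T?)
open import Data.Bool.ListAction using (all; any)
open import Data.Bool.Properties using (T-≡; T-∧; ∧-zeroʳ; if-∧; if-cong)
open import Data.Empty using (⊥-elim)
open import Data.Fin as Fin using (zero; suc; inject₁; fromℕ; toℕ; _≟_)
open import Data.Fin.Permutation.Components using (transpose; transpose-inverse)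
import Data.Fin.Properties as Finₚ
open import Data.Fin.Relation.Unary.Top using (view; ‵fromℕ; ‵inject₁; view-fromℕ; view-inject₁)
open import Data.List using (List; []; _∷_; map; concatMap; foldr; _++_; allFin; filter; length)
import Data.List.Properties as Listₚ
import Data.List.Relation.Unary.All.Properties as Allₚ
import Data.List.Relation.Unary.Any.Properties as Anyₚ
open import Data.Nat using (zero)
import Data.Nat as ℕ
open import Data.Nat.Induction using (<-rec)
import Data.Nat.Properties as ℕₚ
open import Data.Nat.Tactic.RingSolver using (solve-∀)
open import Data.Product using (_,_; ∃; ∃₂; proj₁; proj₂)
open import Data.Sum using (_⊎_; inj₁; inj₂)
open import Function using (_∘_; id; Equivalence)
open import Function.Definitions using (Injective)
open import Relation.Binary.Definitions using (tri<; tri≈; tri>)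
open import Relation.Binary.PropositionalEquality as ≡ using (_≡_; _≢_; _≗_; refl; cong; cong₂)
open import Relation.Nullary using (Dec; yes; no; contradiction)
open import Relation.Nullary.Decidable using (isYes; dec-true; dec-false; toWitness; fromWitness; ⌊⌋-map′)

private
  variable
    m n : ℕ

T-⇔⇒≡ : {a b : Bool} → (T a → T b) → (T b → T a) → a ≡ b
T-⇔⇒≡ {false} {false} _ _ = refl
T-⇔⇒≡ {false} {true}  _ b⇒a = ⊥-elim (b⇒a _)
T-⇔⇒≡ {true}  {false} a⇒b _ = ⊥-elim (a⇒b _)
T-⇔⇒≡ {true}  {true}  _ _ = refl

<ᵇ-true : {a b : ℕ} → a ℕ.< b → (a ℕ.<ᵇ b) ≡ true
<ᵇ-true a<b = T-⇔⇒≡ _ λ _ → ℕₚ.<⇒<ᵇ a<b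

<ᵇ-false : {a b : ℕ} → b ℕ.≤ a → (a ℕ.<ᵇ b) ≡ false
<ᵇ-false {a} {b} b≤a = T-⇔⇒≡ (λ a<b → ℕₚ.<⇒≱ (ℕₚ.<ᵇ⇒< a b a<b) b≤a) λ ()

==-suc : (i j : Fin m) → (suc i == suc j) ≡ (i == j)
==-suc i j = ⌊⌋-map′ (cong suc) Finₚ.suc-injective (i ≟ j)

inject₁<fromℕ : (i : Fin m) → toℕ (inject₁ i) ℕ.< toℕ (fromℕ m)
inject₁<fromℕ {m} i = ≡.subst₂ ℕ._<_ (≡.sym (Finₚ.toℕ-inject₁ i)) (≡.sym (Finₚ.toℕ-fromℕ m)) (Finₚ.toℕ<n i)

all-allFin⁻ : (P : Fin n → Bool) → T (all P (allFin n)) → ∀ i → T (P i)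
all-allFin⁻ P t = Allₚ.tabulate⁻ (Allₚ.all⁺ P (allFin _) t)

all-allFin⁺ : (P : Fin n → Bool) → (∀ i → T (P i)) → T (all P (allFin n))
all-allFin⁺ P h = Allₚ.all⁻ P (Allₚ.tabulate⁺ h)

any-allFin⁻ : (P : Fin n → Bool) → T (any P (allFin n)) → ∃ λ i → T (P i)
any-allFin⁻ P t = Anyₚ.tabulate⁻ (Anyₚ.any⁻ P (allFin _) t)

any-allFin⁺ : (P : Fin n → Bool) (i : Fin n) → T (P i) → T (any P (allFin n))
any-allFin⁺ P i t = Anyₚ.any⁺ P (Anyₚ.tabulate⁺ i t)

module ListSum {c ℓ} (M : CommutativeMonoid c ℓ) where
  open CommutativeMonoid M renaming (refl to ≈-refl; sym to ≈-sym; trans to ≈-trans)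
  open import Relation.Binary.Reasoning.Setoid setoid
  open import Algebra.Properties.CommutativeSemigroup commutativeSemigroup using (interchange)

  ∑ : {X : Set} → List X → (X → Carrier) → Carrier
  ∑ xs h = foldr (λ x r → h x ∙ r) ε xs

  syntax ∑ xs (λ x → e) = ∑[ x ∈ xs ] e

  if-then-cong : (b : Bool) {x y z : Carrier} → x ≈ y → (if b then x else z) ≈ (if b then y else z)
  if-then-cong true  x≈y = x≈y
  if-then-cong false _   = ≈-refl

  ∑-cong : {X : Set} (xs : List X) {g h : X → Carrier} → (∀ x → g x ≈ h x) → ∑ xs g ≈ ∑ xs h
  ∑-cong []       g≈h = ≈-refl
  ∑-cong (x ∷ xs) g≈h = ∙-cong (g≈h x) (∑-cong xs g≈h)

  ∑-++ : {X : Set} (xs ys : List X) (h : X → Carrier) → ∑ (xs ++ ys) h ≈ ∑ xs h ∙ ∑ ys h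
  ∑-++ []       ys h = ≈-sym (identityˡ _)
  ∑-++ (x ∷ xs) ys h = ≈-trans (∙-congˡ (∑-++ xs ys h)) (≈-sym (assoc _ _ _))

  ∑-map : {X Y : Set} (g : X → Y) (xs : List X) (h : Y → Carrier) → ∑ (map g xs) h ≡ ∑ xs (h ∘ g)
  ∑-map g []       h = refl
  ∑-map g (x ∷ xs) h = cong (h (g x) ∙_) (∑-map g xs h)

  ∑-concatMap : {X Y : Set} (g : X → List Y) (xs : List X) (h : Y → Carrier) →
                ∑ (concatMap g xs) h ≈ ∑[ x ∈ xs ] ∑ (g x) h
  ∑-concatMap g []       h = ≈-refl
  ∑-concatMap g (x ∷ xs) h = ≈-trans (∑-++ (g x) (concatMap g xs) h) (∙-congˡ (∑-concatMap g xs h))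

  ∑-ε : {X : Set} (xs : List X) → ∑[ x ∈ xs ] ε ≈ ε
  ∑-ε []       = ≈-refl
  ∑-ε (x ∷ xs) = ≈-trans (identityˡ _) (∑-ε xs)

  ∑-distrib : {X : Set} (xs : List X) (g h : X → Carrier) → ∑[ x ∈ xs ] (g x ∙ h x) ≈ ∑ xs g ∙ ∑ xs h
  ∑-distrib []       g h = ≈-sym (identityˡ _)
  ∑-distrib (x ∷ xs) g h = ≈-trans (∙-congˡ (∑-distrib xs g h)) (interchange _ _ _ _)

  ∑∑-distrib : {X Y : Set} (xs : List X) (ys : List Y) (g h : X → Y → Carrier) →
               ∑[ x ∈ xs ] ∑[ y ∈ ys ] (g x y ∙ h x y) ≈ (∑[ x ∈ xs ] ∑ ys (g x)) ∙ (∑[ x ∈ xs ] ∑ ys (h x))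
  ∑∑-distrib xs ys g h = ≈-trans (∑-cong xs λ x → ∑-distrib ys (g x) (h x)) (∑-distrib xs _ _)

  ∑-comm : {X Y : Set} (xs : List X) (ys : List Y) (h : X → Y → Carrier) →
           ∑[ x ∈ xs ] ∑[ y ∈ ys ] h x y ≈ ∑[ y ∈ ys ] ∑[ x ∈ xs ] h x y
  ∑-comm []       ys h = ≈-sym (∑-ε ys)
  ∑-comm (x ∷ xs) ys h = ≈-trans (∙-congˡ (∑-comm xs ys h)) (≈-sym (∑-distrib ys (h x) _))

  ∑-if : {X : Set} (xs : List X) (b : Bool) (h : X → Carrier) →
         ∑[ x ∈ xs ] (if b then h x else ε) ≈ (if b then ∑ xs h else ε)
  ∑-if xs true  h = ≈-refl
  ∑-if xs false h = ∑-ε xs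

  ∑-filter : {X : Set} (P : X → Bool) (xs : List X) (h : X → Carrier) →
             ∑ (filter (T? ∘ P) xs) h ≈ ∑[ x ∈ xs ] (if P x then h x else ε)
  ∑-filter P []       h = ≈-refl
  ∑-filter P (x ∷ xs) h with P x
  ... | true  = ∙-congˡ (∑-filter P xs h)
  ... | false = ≈-trans (∑-filter P xs h) (≈-sym (identityˡ _))

  ∑-allFin-suc : ∀ n (h : Fin (suc n) → Carrier) → ∑ (allFin (suc n)) h ≈ h zero ∙ ∑ (allFin n) (h ∘ suc)
  ∑-allFin-suc n h = ∙-congˡ (reflexive (≡.trans
    (cong (λ l → ∑ l h) (≡.sym (Listₚ.map-tabulate id suc))) (∑-map suc (allFin n) h)))

  ∑-allFin-inject₁ : ∀ n (h : Fin (suc n) → Carrier) →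
                     ∑ (allFin (suc n)) h ≈ ∑ (allFin n) (h ∘ inject₁) ∙ h (fromℕ n)
  ∑-allFin-inject₁ zero    h = ≈-trans (identityʳ _) (≈-sym (identityˡ _))
  ∑-allFin-inject₁ (suc n) h = begin
    ∑ (allFin (suc (suc n))) h                                          ≈⟨ ∑-allFin-suc (suc n) h ⟩
    h zero ∙ ∑ (allFin (suc n)) (h ∘ suc)                               ≈⟨ ∙-congˡ (∑-allFin-inject₁ n (h ∘ suc)) ⟩
    h zero ∙ (∑ (allFin n) (h ∘ suc ∘ inject₁) ∙ h (fromℕ (suc n)))     ≈⟨ assoc _ _ _ ⟨
    (h zero ∙ ∑ (allFin n) (h ∘ inject₁ ∘ suc)) ∙ h (fromℕ (suc n))     ≈⟨ ∙-congʳ (∑-allFin-suc n (h ∘ inject₁)) ⟨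
    ∑ (allFin (suc n)) (h ∘ inject₁) ∙ h (fromℕ (suc n))                ∎

  ∑-δ : ∀ n (p : Fin n) (h : Fin n → Carrier) → ∑[ j ∈ allFin n ] (if p == j then h j else ε) ≈ h p
  ∑-δ (suc n) zero    h = ≈-trans (∑-allFin-suc n _) (≈-trans (∙-congˡ (∑-ε (allFin n))) (identityʳ _))
  ∑-δ (suc n) (suc p) h = begin
    ∑[ j ∈ allFin (suc n) ] (if suc p == j then h j else ε)
      ≈⟨ ≈-trans (∑-allFin-suc n _) (identityˡ _) ⟩
    ∑[ j ∈ allFin n ] (if suc p == suc j then h (suc j) else ε)
      ≈⟨ ∑-cong (allFin n) (λ j → reflexive (if-cong (==-suc p j))) ⟩
    ∑[ j ∈ allFin n ] (if p == j then h (suc j) else ε)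
      ≈⟨ ∑-δ n p (h ∘ suc) ⟩
    h (suc p) ∎

injective-resp-≗ : {f g : Fin m → Fin n} → f ≗ g → Injective _≡_ _≡_ f → Injective _≡_ _≡_ g
injective-resp-≗ {f = f} {g} f≗g f-inj {x} {y} eq = f-inj (≡.trans (f≗g x) (≡.trans eq (≡.sym (f≗g y))))

isPerm⇒injective : {σ : Fin m → Fin m} → T (isPerm σ) → Injective _≡_ _≡_ σ
isPerm⇒injective {σ = σ} perm {i} {j} σi≡σj = decide (all-allFin⁻ _ (all-allFin⁻ _ perm i) j)
  where
  decide : T ((i == j) ∨ not (σ i == σ j)) → i ≡ j
  decide t with i ≟ j | σ i ≟ σ j
  ... | yes i≡j | _        = i≡j
  ... | no _    | yes _    = ⊥-elim t
  ... | no _    | no σi≢σj = contradiction σi≡σj σi≢σj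

injective⇒isPerm : {σ : Fin m → Fin m} → Injective _≡_ _≡_ σ → T (isPerm σ)
injective⇒isPerm {σ = σ} σ-inj = all-allFin⁺ _ λ i → all-allFin⁺ _ λ j → entry i j
  where
  entry : ∀ i j → T ((i == j) ∨ not (σ i == σ j))
  entry i j with i ≟ j | σ i ≟ σ j
  ... | yes _   | _         = _
  ... | no i≢j  | yes σi≡σj = contradiction (σ-inj σi≡σj) i≢j
  ... | no _    | no _      = _

-- Inserting a top point into a permutation

transpose-matchˡ : (i j : Fin m) → transpose i j i ≡ j
transpose-matchˡ i j rewrite dec-true (i ≟ i) refl = refl

transpose-matchʳ : (i j : Fin m) → transpose i j j ≡ i
transpose-matchʳ i j with j ≟ i
... | yes j≡i = j≡i
... | no _ rewrite dec-true (j ≟ j) refl = refl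

transpose-mismatch : {i j k : Fin m} → k ≢ i → k ≢ j → transpose i j k ≡ k
transpose-mismatch {i = i} {j} {k} k≢i k≢j rewrite dec-false (k ≟ i) k≢i | dec-false (k ≟ j) k≢j = refl

transpose-injective : (i j : Fin m) → Injective _≡_ _≡_ (transpose i j)
transpose-injective i j {k} {l} eq = begin
  k                                ≡⟨ transpose-inverse j i ⟨
  transpose j i (transpose i j k)  ≡⟨ cong (transpose j i) eq ⟩
  transpose j i (transpose i j l)  ≡⟨ transpose-inverse j i ⟩
  l                                ∎
  where open ≡.≡-Reasoning

extend : (Fin m → Fin m) → Fin (suc m) → Fin (suc m)
extend τ k with view k
... | ‵fromℕ     = fromℕ _
... | ‵inject₁ j = inject₁ (τ j)

extend-fromℕ : (τ : Fin m → Fin m) → extend τ (fromℕ m) ≡ fromℕ m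
extend-fromℕ {m} τ rewrite view-fromℕ m = refl

extend-inject₁ : (τ : Fin m → Fin m) (k : Fin m) → extend τ (inject₁ k) ≡ inject₁ (τ k)
extend-inject₁ τ k rewrite view-inject₁ k = refl

extend-injective : {τ : Fin m → Fin m} → Injective _≡_ _≡_ τ → Injective _≡_ _≡_ (extend τ)
extend-injective τ-inj {k} {l} eq with view k | view l
... | ‵fromℕ     | ‵fromℕ     = refl
... | ‵fromℕ     | ‵inject₁ _ = contradiction eq Finₚ.fromℕ≢inject₁
... | ‵inject₁ _ | ‵fromℕ     = contradiction (≡.sym eq) Finₚ.fromℕ≢inject₁
... | ‵inject₁ _ | ‵inject₁ _ = cong inject₁ (τ-inj (Finₚ.inject₁-injective eq))

extend≡fromℕ : (τ : Fin m → Fin m) {k : Fin (suc m)} → extend τ k ≡ fromℕ m → k ≡ fromℕ m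
extend≡fromℕ τ {k} eq with view k
... | ‵fromℕ     = refl
... | ‵inject₁ _ = contradiction (≡.sym eq) Finₚ.fromℕ≢inject₁

extend-cong : {τ τ′ : Fin m → Fin m} → τ ≗ τ′ → extend τ ≗ extend τ′
extend-cong τ≗τ′ k with view k
... | ‵fromℕ     = refl
... | ‵inject₁ j = cong inject₁ (τ≗τ′ j)

extend-injective⁻ : {τ : Fin m → Fin m} → Injective _≡_ _≡_ (extend τ) → Injective _≡_ _≡_ τ
extend-injective⁻ {τ = τ} ext-inj {k} {l} eq = Finₚ.inject₁-injective (ext-inj (begin
  extend τ (inject₁ k)  ≡⟨ extend-inject₁ τ k ⟩
  inject₁ (τ k)         ≡⟨ cong inject₁ eq ⟩
  inject₁ (τ l)         ≡⟨ extend-inject₁ τ l ⟨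
  extend τ (inject₁ l)  ∎))
  where open ≡.≡-Reasoning

-- The fromℕ branch is junk: it is never taken when π is injective and fixes fromℕ m.
restrict : (Fin (suc m) → Fin (suc m)) → Fin m → Fin m
restrict π k with π (inject₁ k) | view (π (inject₁ k))
... | _ | ‵inject₁ j = j
... | _ | ‵fromℕ     = k

extend-restrict : {π : Fin (suc m) → Fin (suc m)} → Injective _≡_ _≡_ π → π (fromℕ m) ≡ fromℕ m →
                  extend (restrict π) ≗ π
extend-restrict {π = π} π-inj π-fix k with view k
... | ‵fromℕ     = ≡.sym π-fix
... | ‵inject₁ j with π (inject₁ j) in eq | view (π (inject₁ j))
...   | _ | ‵inject₁ _ = refl
...   | _ | ‵fromℕ     = contradiction (π-inj (≡.trans eq (≡.sym π-fix))) (λ e → Finₚ.fromℕ≢inject₁ (≡.sym e))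

-- insert τ p sends p ↦ m ↦ τ p: the new top point m is spliced into the cycle of p right after p,
-- or becomes a fixed point when p = m.
insert : (Fin m → Fin m) → Fin (suc m) → Fin (suc m) → Fin (suc m)
insert τ p = extend τ ∘ transpose p (fromℕ _)

module _ (τ : Fin m → Fin m) (p : Fin (suc m)) where

  insert-pivot : insert τ p p ≡ fromℕ m
  insert-pivot = ≡.trans (cong (extend τ) (transpose-matchˡ p (fromℕ m))) (extend-fromℕ τ)

  insert-fromℕ : insert τ p (fromℕ m) ≡ extend τ p
  insert-fromℕ = cong (extend τ) (transpose-matchʳ p (fromℕ m))

  insert-inject₁ : (k : Fin m) → inject₁ k ≢ p → insert τ p (inject₁ k) ≡ inject₁ (τ k)
  insert-inject₁ k k≢p = ≡.trans (cong (extend τ) (transpose-mismatch k≢p (Finₚ.fromℕ≢inject₁ ∘ ≡.sym)))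
                                 (extend-inject₁ τ k)

  insert≡fromℕ : {k : Fin (suc m)} → insert τ p k ≡ fromℕ m → k ≡ p
  insert≡fromℕ eq = transpose-injective p (fromℕ m)
    (≡.trans (extend≡fromℕ τ eq) (≡.sym (transpose-matchˡ p (fromℕ m))))

  extend≗insert∘transpose : extend τ ≗ insert τ p ∘ transpose (fromℕ m) p
  extend≗insert∘transpose k = cong (extend τ) (≡.sym (transpose-inverse p (fromℕ m) {k}))

  insert-injective : Injective _≡_ _≡_ τ → Injective _≡_ _≡_ (insert τ p)
  insert-injective τ-inj = transpose-injective p (fromℕ m) ∘ extend-injective τ-inj

insert-cong : {τ τ′ : Fin m → Fin m} → τ ≗ τ′ → (p : Fin (suc m)) → insert τ p ≗ insert τ′ p
insert-cong τ≗τ′ p k = extend-cong τ≗τ′ (transpose p (fromℕ _) k)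

insert-unique : {τ τ′ : Fin m → Fin m} {p p′ : Fin (suc m)} →
                insert τ p ≗ insert τ′ p′ → τ ≗ τ′ × p ≡ p′
insert-unique {m} {τ} {τ′} {p} {p′} eq
  with refl ← ≡.sym (insert≡fromℕ τ p {p′} (≡.trans (eq p′) (insert-pivot τ′ p′))) = τ≗τ′ , refl
  where
  τ≗τ′ : τ ≗ τ′
  τ≗τ′ k = Finₚ.inject₁-injective (begin
    inject₁ (τ k)                                  ≡⟨ extend-inject₁ τ k ⟨
    extend τ (inject₁ k)                           ≡⟨ extend≗insert∘transpose τ p (inject₁ k) ⟩
    insert τ p (transpose (fromℕ m) p (inject₁ k))  ≡⟨ eq (transpose (fromℕ m) p (inject₁ k)) ⟩
    insert τ′ p (transpose (fromℕ m) p (inject₁ k)) ≡⟨ extend≗insert∘transpose τ′ p (inject₁ k) ⟨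
    extend τ′ (inject₁ k)                          ≡⟨ extend-inject₁ τ′ k ⟩
    inject₁ (τ′ k)                                 ∎)
    where open ≡.≡-Reasoning

injective⇒hits-fromℕ : {σ : Fin (suc m) → Fin (suc m)} → Injective _≡_ _≡_ σ → ∃ λ p → σ p ≡ fromℕ m
injective⇒hits-fromℕ {m} {σ} σ-inj with p , _ , fromℕ≤σp ← Finₚ.injective⇒existsPivot σ-inj (fromℕ m) =
  p , Finₚ.≤-antisym (Finₚ.≤fromℕ (σ p)) fromℕ≤σp

insert-surjective : {σ : Fin (suc m) → Fin (suc m)} → Injective _≡_ _≡_ σ →
                    ∃₂ λ τ p → Injective _≡_ _≡_ τ × insert τ p ≗ σ
insert-surjective {m} {σ} σ-inj with p , σp≡fromℕ ← injective⇒hits-fromℕ σ-inj =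
  restrict π , p , extend-injective⁻ (injective-resp-≗ (≡.sym ∘ extend≗π) π-inj) , insert≗σ
  where
  π : Fin (suc m) → Fin (suc m)
  π = σ ∘ transpose (fromℕ m) p
  π-inj : Injective _≡_ _≡_ π
  π-inj = transpose-injective (fromℕ m) p ∘ σ-inj
  extend≗π : extend (restrict π) ≗ π
  extend≗π = extend-restrict π-inj (≡.trans (cong σ (transpose-matchˡ (fromℕ m) p)) σp≡fromℕ)
  insert≗σ : insert (restrict π) p ≗ σ
  insert≗σ k = ≡.trans (extend≗π (transpose p (fromℕ m) k)) (cong σ (transpose-inverse (fromℕ m) p))

-- Orbits and cycle leaders

Reach : (Fin n → Fin n) → Fin n → Fin n → Set
Reach σ i j = ∃ λ t → iter σ t i ≡ j

iter-+ : (σ : Fin n → Fin n) (s t : ℕ) (i : Fin n) → iter σ (s ℕ.+ t) i ≡ iter σ s (iter σ t i)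
iter-+ σ zero    t i = refl
iter-+ σ (suc s) t i = cong σ (iter-+ σ s t i)

iter-cong : {σ σ′ : Fin n → Fin n} → σ ≗ σ′ → ∀ t i → iter σ t i ≡ iter σ′ t i
iter-cong σ≗σ′ zero    i = refl
iter-cong {σ = σ} {σ′} σ≗σ′ (suc t) i = ≡.trans (cong σ (iter-cong σ≗σ′ t i)) (σ≗σ′ _)

module _ {σ : Fin n → Fin n} where

  reach-refl : {i : Fin n} → Reach σ i i
  reach-refl = 0 , refl

  reach-step : (i : Fin n) → Reach σ i (σ i)
  reach-step i = 1 , refl

  reach-trans : {i j k : Fin n} → Reach σ i j → Reach σ j k → Reach σ i k
  reach-trans {i} (s , refl) (t , refl) = t ℕ.+ s , iter-+ σ t s i

reach-resp-≗ : {σ σ′ : Fin n → Fin n} → σ ≗ σ′ → {i j : Fin n} → Reach σ i j → Reach σ′ i j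
reach-resp-≗ σ≗σ′ {i} (t , eq) = t , ≡.trans (≡.sym (iter-cong σ≗σ′ t i)) eq

-- A pigeonhole repetition among the first n + 1 iterates cuts a loop out of the orbit.
iter-shortcut : (σ : Fin n → Fin n) (i : Fin n) (t : ℕ) → ∃ λ s → s ℕ.< n × iter σ s i ≡ iter σ t i
iter-shortcut {n} σ i = <-rec _ shorten
  where
  Short : ℕ → Set
  Short t = ∃ λ s → s ℕ.< n × iter σ s i ≡ iter σ t i
  shorten : ∀ t → (∀ {t′} → t′ ℕ.< t → Short t′) → Short t
  shorten t rec with t ℕ.<? n
  ... | yes t<n = t , t<n , refl
  ... | no t≮n with a , b , a<b , σᵃi≡σᵇi ← Finₚ.pigeonhole (ℕₚ.n<1+n n) (λ k → iter σ (toℕ k) i) =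
    let s , s<n , eq = rec (≡.subst (d ℕ.+ toℕ a ℕ.<_) d+b≡t (ℕₚ.+-monoʳ-< d a<b))
    in  s , s<n , ≡.trans eq (begin
      iter σ (d ℕ.+ toℕ a) i     ≡⟨ iter-+ σ d (toℕ a) i ⟩
      iter σ d (iter σ (toℕ a) i) ≡⟨ cong (iter σ d) σᵃi≡σᵇi ⟩
      iter σ d (iter σ (toℕ b) i) ≡⟨ iter-+ σ d (toℕ b) i ⟨
      iter σ (d ℕ.+ toℕ b) i     ≡⟨ cong (λ u → iter σ u i) d+b≡t ⟩
      iter σ t i                 ∎)
    where
    open ≡.≡-Reasoning
    d = t ℕ.∸ toℕ b
    d+b≡t : d ℕ.+ toℕ b ≡ t
    d+b≡t = ℕₚ.m∸n+n≡m (ℕₚ.≤-trans (Finₚ.toℕ≤pred[n] b) (ℕₚ.≮⇒≥ t≮n))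

inCycle⇒Reach : {σ : Fin n → Fin n} {i j : Fin n} → T (inCycle σ i j) → Reach σ i j
inCycle⇒Reach {n} {σ} {i} {j} c with t , eq ← any-allFin⁻ {n} (λ t → iter σ (toℕ t) i == j) c =
  toℕ t , toWitness eq

Reach⇒inCycle : {σ : Fin n → Fin n} {i j : Fin n} → Reach σ i j → T (inCycle σ i j)
Reach⇒inCycle {σ = σ} {i} (t , refl) with s , s<n , eq ← iter-shortcut σ i t =
  any-allFin⁺ _ (Fin.fromℕ< s<n) (fromWitness (≡.trans (cong (λ u → iter σ u i) (Finₚ.toℕ-fromℕ< s<n)) eq))

module _ {σ : Fin n → Fin n} {i : Fin n} where

  isLeader⇒minimal : T (isLeader σ i) → ∀ {j} → Reach σ i j → toℕ i ℕ.≤ toℕ j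
  isLeader⇒minimal leader {j} r = decide (all-allFin⁻ _ leader j)
    where
    decide : T (not (inCycle σ i j) ∨ (toℕ i ℕ.≤ᵇ toℕ j)) → toℕ i ℕ.≤ toℕ j
    decide t with inCycle σ i j | Reach⇒inCycle {σ = σ} r
    ... | true  | _  = ℕₚ.≤ᵇ⇒≤ (toℕ i) (toℕ j) t
    ... | false | ()

  minimal⇒isLeader : (∀ {j} → Reach σ i j → toℕ i ℕ.≤ toℕ j) → T (isLeader σ i)
  minimal⇒isLeader minimal = all-allFin⁺ _ entry
    where
    entry : ∀ j → T (not (inCycle σ i j) ∨ (toℕ i ℕ.≤ᵇ toℕ j))
    entry j with inCycle σ i j | inCycle⇒Reach {σ = σ} {i} {j}
    ... | false | _       = _
    ... | true  | toReach = ℕₚ.≤⇒≤ᵇ (minimal (toReach _))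

isLeader-resp-≗ : {σ σ′ : Fin n → Fin n} → σ ≗ σ′ → ∀ i → isLeader σ i ≡ isLeader σ′ i
isLeader-resp-≗ σ≗σ′ i = T-⇔⇒≡
  (λ leader → minimal⇒isLeader (isLeader⇒minimal leader ∘ reach-resp-≗ (≡.sym ∘ σ≗σ′)))
  (λ leader → minimal⇒isLeader (isLeader⇒minimal leader ∘ reach-resp-≗ σ≗σ′))

lowerOr : Fin m → Fin (suc m) → Fin m
lowerOr d k with view k
... | ‵fromℕ     = d
... | ‵inject₁ j = j

lowerOr-fromℕ : (d : Fin m) → lowerOr d (fromℕ m) ≡ d
lowerOr-fromℕ {m} d rewrite view-fromℕ m = refl

lowerOr-inject₁ : (d j : Fin m) → lowerOr d (inject₁ j) ≡ j
lowerOr-inject₁ d j rewrite view-inject₁ j = refl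

fromℕ-or-inject₁-lowerOr : (d : Fin m) (p : Fin (suc m)) → p ≡ fromℕ m ⊎ p ≡ inject₁ (lowerOr d p)
fromℕ-or-inject₁-lowerOr d p with view p
... | ‵fromℕ     = inj₁ refl
... | ‵inject₁ _ = inj₂ refl

module _ (τ : Fin m → Fin m) (p : Fin (suc m)) where
  private
    σ = insert τ p

  insert-reach-step : (y : Fin m) → Reach σ (inject₁ y) (inject₁ (τ y))
  insert-reach-step y with inject₁ y ≟ p
  ... | yes refl = 2 , ≡.trans (cong σ (insert-pivot τ p)) (≡.trans (insert-fromℕ τ p) (extend-inject₁ τ y))
  ... | no y≢p   = 1 , insert-inject₁ τ p y y≢p

  reach-insert⁺ : {i j : Fin m} → Reach τ i j → Reach σ (inject₁ i) (inject₁ j)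
  reach-insert⁺ (zero  , refl) = reach-refl
  reach-insert⁺ (suc t , refl) = reach-trans (reach-insert⁺ (t , refl)) (insert-reach-step _)

  -- Reading the top point as d (the point σ maps to it when p = inject₁ d), each σ-step is a τ-step or none.
  lowerOr-insert : (d : Fin m) → p ≡ fromℕ m ⊎ p ≡ inject₁ d → ∀ k →
                   lowerOr d (σ k) ≡ lowerOr d k ⊎ lowerOr d (σ k) ≡ τ (lowerOr d k)
  lowerOr-insert d p≡ k with view k | p≡
  ... | ‵fromℕ | inj₁ refl =
    inj₁ (≡.trans (cong (lowerOr d) (≡.trans (insert-fromℕ τ p) (extend-fromℕ τ))) (lowerOr-fromℕ d))
  ... | ‵fromℕ | inj₂ refl =
    inj₂ (≡.trans (cong (lowerOr d) (≡.trans (insert-fromℕ τ p) (extend-inject₁ τ d))) (lowerOr-inject₁ d (τ d)))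
  ... | ‵inject₁ y | _ = atInject₁ p≡ (inject₁ y ≟ p)
    where
    atInject₁ : p ≡ fromℕ m ⊎ p ≡ inject₁ d → Dec (inject₁ y ≡ p) →
                lowerOr d (σ (inject₁ y)) ≡ y ⊎ lowerOr d (σ (inject₁ y)) ≡ τ y
    atInject₁ _ (no y≢p) = inj₂ (≡.trans (cong (lowerOr d) (insert-inject₁ τ p y y≢p)) (lowerOr-inject₁ d (τ y)))
    atInject₁ (inj₁ y≡fromℕ) (yes refl) = contradiction (≡.sym y≡fromℕ) Finₚ.fromℕ≢inject₁
    atInject₁ (inj₂ y≡d)     (yes refl) = inj₁ (≡.trans (cong (lowerOr d) (insert-pivot τ p))
                                            (≡.trans (lowerOr-fromℕ d) (≡.sym (Finₚ.inject₁-injective y≡d))))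

  reach-insert⁻ : {i j : Fin m} → Reach σ (inject₁ i) (inject₁ j) → Reach τ i j
  reach-insert⁻ {i} {j} (t , eq) = ≡.subst (Reach τ i) (≡.trans (cong (lowerOr d) eq) (lowerOr-inject₁ d j)) (orbit t)
    where
    d : Fin m
    d = lowerOr i p
    orbit : ∀ t → Reach τ i (lowerOr d (iter σ t (inject₁ i)))
    orbit zero = ≡.subst (Reach τ i) (≡.sym (lowerOr-inject₁ d i)) reach-refl
    orbit (suc t) with lowerOr-insert d (fromℕ-or-inject₁-lowerOr i p) (iter σ t (inject₁ i))
    ... | inj₁ same = ≡.subst (Reach τ i) (≡.sym same) (orbit t)
    ... | inj₂ next = ≡.subst (Reach τ i) (≡.sym next) (reach-trans (orbit t) (reach-step _))

  isLeader-insert-inject₁ : (i : Fin m) → isLeader σ (inject₁ i) ≡ isLeader τ i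
  isLeader-insert-inject₁ i = T-⇔⇒≡
    (λ leader → minimal⇒isLeader λ {j} r →
       ≡.subst₂ ℕ._≤_ (Finₚ.toℕ-inject₁ i) (Finₚ.toℕ-inject₁ j) (isLeader⇒minimal leader (reach-insert⁺ r)))
    (λ leader → minimal⇒isLeader λ {k} r → bound leader k r)
    where
    bound : T (isLeader τ i) → ∀ k → Reach σ (inject₁ i) k → toℕ (inject₁ i) ℕ.≤ toℕ k
    bound leader k r with view k
    ... | ‵fromℕ     = Finₚ.≤fromℕ (inject₁ i)
    ... | ‵inject₁ j = ≡.subst₂ ℕ._≤_ (≡.sym (Finₚ.toℕ-inject₁ i)) (≡.sym (Finₚ.toℕ-inject₁ j))
                                 (isLeader⇒minimal leader (reach-insert⁻ r))

isLeader-insert-fromℕ : (τ : Fin m → Fin m) → isLeader (insert τ (fromℕ m)) (fromℕ m) ≡ true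
isLeader-insert-fromℕ {m} τ =
  T-⇔⇒≡ _ λ _ → minimal⇒isLeader λ { (t , refl) → ℕₚ.≤-reflexive (cong toℕ (≡.sym (fixed t))) }
  where
  fixed : ∀ t → iter (insert τ (fromℕ m)) t (fromℕ m) ≡ fromℕ m
  fixed zero    = refl
  fixed (suc t) = ≡.trans (cong (insert τ (fromℕ m)) (fixed t)) (insert-pivot τ (fromℕ m))

isLeader-insert-inject₁-fromℕ : (τ : Fin m → Fin m) (p : Fin m) →
                                isLeader (insert τ (inject₁ p)) (fromℕ m) ≡ false
isLeader-insert-inject₁-fromℕ {m} τ p =
  T-⇔⇒≡ (λ leader → ℕₚ.<⇒≱ (inject₁<fromℕ (τ p)) (isLeader⇒minimal leader (1 , σm≡τp))) λ ()
  where
  σm≡τp : insert τ (inject₁ p) (fromℕ m) ≡ inject₁ (τ p)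
  σm≡τp = ≡.trans (insert-fromℕ τ (inject₁ p)) (extend-inject₁ τ p)

-- Inversions

⟦_⟧ : Bool → ℕ
⟦ b ⟧ = if b then 1 else 0

inverted : (Fin m → ℕ) → Fin m → Fin m → Bool
inverted s i j = (toℕ i ℕ.<ᵇ toℕ j) ∧ (s j ℕ.<ᵇ s i)

even-suc : ∀ n → even (suc n) ≡ not (even n)
even-suc zero          = refl
even-suc (suc zero)    = refl
even-suc (suc (suc n)) = even-suc n

even-+-double : ∀ n z → even (n ℕ.+ (z ℕ.+ z)) ≡ even n
even-+-double n zero    = cong even (ℕₚ.+-identityʳ n)
even-+-double n (suc z) = ≡.trans (cong even (two-more n z)) (even-+-double n z)
  where
  two-more : ∀ n z → n ℕ.+ (suc z ℕ.+ suc z) ≡ suc (suc (n ℕ.+ (z ℕ.+ z)))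
  two-more = solve-∀

module _ where
  open ListSum ℕₚ.+-0-commutativeMonoid

  inversionCount : (Fin m → ℕ) → ℕ
  inversionCount {m} s = ∑[ i ∈ allFin m ] ∑[ j ∈ allFin m ] ⟦ inverted s i j ⟧

  length-filter : {X : Set} (P : X → Bool) (xs : List X) → length (filter (T? ∘ P) xs) ≡ ∑ xs (⟦_⟧ ∘ P)
  length-filter P []       = refl
  length-filter P (x ∷ xs) with P x
  ... | true  = cong suc (length-filter P xs)
  ... | false = length-filter P xs

  inversions≡inversionCount : (σ : Fin m → Fin m) → inversions σ ≡ inversionCount (toℕ ∘ σ)
  inversions≡inversionCount {m} σ = begin
    inversions σ
      ≡⟨ length-filter (λ (i , j) → inverted (toℕ ∘ σ) i j) (concatMap pairsFrom (allFin m)) ⟩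
    ∑ (concatMap pairsFrom (allFin m)) (λ (i , j) → ⟦ inverted (toℕ ∘ σ) i j ⟧)
      ≡⟨ ∑-concatMap pairsFrom (allFin m) _ ⟩
    ∑[ i ∈ allFin m ] ∑ (pairsFrom i) (λ (i , j) → ⟦ inverted (toℕ ∘ σ) i j ⟧)
      ≡⟨ ∑-cong (allFin m) (λ i → ∑-map (i ,_) (allFin m) _) ⟩
    inversionCount (toℕ ∘ σ) ∎
    where
    open ≡.≡-Reasoning
    pairsFrom : Fin m → List (Fin m × Fin m)
    pairsFrom i = map (i ,_) (allFin m)

  inversionCount-cong : {s s′ : Fin m → ℕ} → s ≗ s′ → inversionCount s ≡ inversionCount s′
  inversionCount-cong {m} s≗s′ = ∑-cong (allFin m) λ i → ∑-cong (allFin m) λ j →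
    cong₂ (λ a b → ⟦ (toℕ i ℕ.<ᵇ toℕ j) ∧ (a ℕ.<ᵇ b) ⟧) (s≗s′ j) (s≗s′ i)

  inversionCount-split : (s : Fin (suc m) → ℕ) → inversionCount s ≡
    inversionCount (s ∘ inject₁) ℕ.+ ∑[ i ∈ allFin m ] ⟦ s (fromℕ m) ℕ.<ᵇ s (inject₁ i) ⟧
  inversionCount-split {m} s = begin
    inversionCount s
      ≡⟨ ∑-allFin-inject₁ m row ⟩
    ∑[ i ∈ allFin m ] row (inject₁ i) ℕ.+ row (fromℕ m)
      ≡⟨ cong₂ ℕ._+_ (∑-cong (allFin m) λ i → ∑-allFin-inject₁ m (λ l → ⟦ inverted s (inject₁ i) l ⟧)) lastRow≡0 ⟩
    ∑[ i ∈ allFin m ] (∑[ j ∈ allFin m ] ⟦ inverted s (inject₁ i) (inject₁ j) ⟧ ℕ.+ ⟦ inverted s (inject₁ i) (fromℕ m) ⟧) ℕ.+ 0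
      ≡⟨ ≡.trans (ℕₚ.+-identityʳ _) (∑-distrib (allFin m) _ _) ⟩
    ∑[ i ∈ allFin m ] ∑[ j ∈ allFin m ] ⟦ inverted s (inject₁ i) (inject₁ j) ⟧
      ℕ.+ ∑[ i ∈ allFin m ] ⟦ inverted s (inject₁ i) (fromℕ m) ⟧
      ≡⟨ cong₂ ℕ._+_ (∑-cong (allFin m) λ i → ∑-cong (allFin m) (block i)) (∑-cong (allFin m) lastColumn) ⟩
    inversionCount (s ∘ inject₁) ℕ.+ ∑[ i ∈ allFin m ] ⟦ s (fromℕ m) ℕ.<ᵇ s (inject₁ i) ⟧ ∎
    where
    open ≡.≡-Reasoning
    row : Fin (suc m) → ℕ
    row k = ∑[ l ∈ allFin (suc m) ] ⟦ inverted s k l ⟧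
    lastRow≡0 : row (fromℕ m) ≡ 0
    lastRow≡0 = ≡.trans (∑-cong (allFin (suc m)) λ l →
                          cong (λ a → ⟦ a ∧ (s l ℕ.<ᵇ s (fromℕ m)) ⟧) (<ᵇ-false (Finₚ.≤fromℕ l)))
                        (∑-ε (allFin (suc m)))
    block : ∀ i j → ⟦ inverted s (inject₁ i) (inject₁ j) ⟧ ≡ ⟦ inverted (s ∘ inject₁) i j ⟧
    block i j = cong₂ (λ a b → ⟦ (a ℕ.<ᵇ b) ∧ (s (inject₁ j) ℕ.<ᵇ s (inject₁ i)) ⟧)
                      (Finₚ.toℕ-inject₁ i) (Finₚ.toℕ-inject₁ j)
    lastColumn : ∀ i → ⟦ inverted s (inject₁ i) (fromℕ m) ⟧ ≡ ⟦ s (fromℕ m) ℕ.<ᵇ s (inject₁ i) ⟧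
    lastColumn i = cong (λ a → ⟦ a ∧ (s (fromℕ m) ℕ.<ᵇ s (inject₁ i)) ⟧) (<ᵇ-true (inject₁<fromℕ i))

  -- On Fin m, toℕ ∘ insert τ (inject₁ p) is raise (toℕ ∘ τ) p m; its last column compares with toℕ (τ p).
  raise : (Fin m → ℕ) → Fin m → ℕ → Fin m → ℕ
  raise s p M k = if p == k then M else s k

  module _ (s : Fin m → ℕ) (s-inj : Injective _≡_ _≡_ s) {M : ℕ} (s<M : ∀ i → s i ℕ.< M) (p : Fin m) where
    aboveˡ aboveʳ : Fin m → ℕ
    aboveˡ i = ⟦ (toℕ i ℕ.<ᵇ toℕ p) ∧ (s p ℕ.<ᵇ s i) ⟧
    aboveʳ j = ⟦ (toℕ p ℕ.<ᵇ toℕ j) ∧ (s p ℕ.<ᵇ s j) ⟧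

    private
      <ᵇ-irrefl : ∀ n → (n ℕ.<ᵇ n) ≡ false
      <ᵇ-irrefl n = <ᵇ-false {n} ℕₚ.≤-refl

    inverted-raise : ∀ i j → ⟦ inverted (raise s p M) i j ⟧ ℕ.+ (if p == j then aboveˡ i else 0)
                           ≡ ⟦ inverted s i j ⟧ ℕ.+ (if p == i then aboveʳ j else 0)
    inverted-raise i j with p ≟ i | p ≟ j
    ... | yes refl | yes refl rewrite <ᵇ-irrefl (toℕ p) = refl
    ... | yes refl | no p≢j rewrite <ᵇ-true (s<M j) with ℕₚ.<-cmp (s j) (s p)
    ...   | tri< lt _ _ rewrite <ᵇ-true lt | <ᵇ-false (ℕₚ.<⇒≤ lt) | ∧-zeroʳ (toℕ p ℕ.<ᵇ toℕ j) = refl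
    ...   | tri≈ _ eq _ = contradiction (s-inj eq) (p≢j ∘ ≡.sym)
    ...   | tri> _ _ gt rewrite <ᵇ-false (ℕₚ.<⇒≤ gt) | <ᵇ-true gt | ∧-zeroʳ (toℕ p ℕ.<ᵇ toℕ j) = ℕₚ.+-comm _ 0
    inverted-raise i j | no p≢i | yes refl
      rewrite <ᵇ-false (ℕₚ.<⇒≤ (s<M i)) | ∧-zeroʳ (toℕ i ℕ.<ᵇ toℕ p) = ℕₚ.+-comm 0 _
    inverted-raise i j | no p≢i | no p≢j = refl

    <ᵇ-raise : ∀ i → ⟦ s p ℕ.<ᵇ raise s p M i ⟧ ≡ aboveˡ i ℕ.+ aboveʳ i ℕ.+ (if p == i then 1 else 0)
    <ᵇ-raise i with p ≟ i
    ... | yes refl rewrite <ᵇ-true (s<M p) | <ᵇ-irrefl (toℕ p) = refl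
    ... | no p≢i with ℕₚ.<-cmp (toℕ i) (toℕ p)
    ...   | tri< lt _ _ rewrite <ᵇ-true lt | <ᵇ-false (ℕₚ.<⇒≤ lt) =
      ≡.sym (≡.trans (ℕₚ.+-identityʳ _) (ℕₚ.+-identityʳ _))
    ...   | tri≈ _ eq _ = contradiction (Finₚ.toℕ-injective eq) (p≢i ∘ ≡.sym)
    ...   | tri> _ _ gt rewrite <ᵇ-true gt | <ᵇ-false (ℕₚ.<⇒≤ gt) = ≡.sym (ℕₚ.+-identityʳ _)

    inversionCount-raise-block : inversionCount (raise s p M) ℕ.+ ∑ (allFin m) aboveˡ
                               ≡ inversionCount s ℕ.+ ∑ (allFin m) aboveʳ
    inversionCount-raise-block = begin
      inversionCount (raise s p M) ℕ.+ ∑ (allFin m) aboveˡ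
        ≡⟨ cong (inversionCount (raise s p M) ℕ.+_) (∑-cong (allFin m) λ i → ∑-δ m p (λ _ → aboveˡ i)) ⟨
      inversionCount (raise s p M) ℕ.+ ∑[ i ∈ allFin m ] ∑[ j ∈ allFin m ] (if p == j then aboveˡ i else 0)
        ≡⟨ ∑∑-distrib (allFin m) (allFin m) (λ i j → ⟦ inverted (raise s p M) i j ⟧) _ ⟨
      ∑[ i ∈ allFin m ] ∑[ j ∈ allFin m ] (⟦ inverted (raise s p M) i j ⟧ ℕ.+ (if p == j then aboveˡ i else 0))
        ≡⟨ ∑-cong (allFin m) (λ i → ∑-cong (allFin m) (inverted-raise i)) ⟩
      ∑[ i ∈ allFin m ] ∑[ j ∈ allFin m ] (⟦ inverted s i j ⟧ ℕ.+ (if p == i then aboveʳ j else 0))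
        ≡⟨ ∑∑-distrib (allFin m) (allFin m) (λ i j → ⟦ inverted s i j ⟧) _ ⟩
      inversionCount s ℕ.+ ∑[ i ∈ allFin m ] ∑[ j ∈ allFin m ] (if p == i then aboveʳ j else 0)
        ≡⟨ cong (inversionCount s ℕ.+_) (≡.trans (∑-cong (allFin m) λ i → ∑-if (allFin m) (p == i) aboveʳ)
                                                 (∑-δ m p (λ _ → ∑ (allFin m) aboveʳ))) ⟩
      inversionCount s ℕ.+ ∑ (allFin m) aboveʳ ∎
      where open ≡.≡-Reasoning

    lastColumn-raise : ∑[ i ∈ allFin m ] ⟦ s p ℕ.<ᵇ raise s p M i ⟧
                     ≡ ∑ (allFin m) aboveˡ ℕ.+ ∑ (allFin m) aboveʳ ℕ.+ 1
    lastColumn-raise = ≡.trans (∑-cong (allFin m) <ᵇ-raise) (≡.trans (∑-distrib (allFin m) _ _)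
      (cong₂ ℕ._+_ (∑-distrib (allFin m) aboveˡ aboveʳ) (∑-δ m p (λ _ → 1))))

    inversionCount-raise : inversionCount (raise s p M) ℕ.+ ∑[ i ∈ allFin m ] ⟦ s p ℕ.<ᵇ raise s p M i ⟧
                         ≡ suc (inversionCount s ℕ.+ (∑ (allFin m) aboveʳ ℕ.+ ∑ (allFin m) aboveʳ))
    inversionCount-raise = begin
      R ℕ.+ ∑[ i ∈ allFin m ] ⟦ s p ℕ.<ᵇ raise s p M i ⟧  ≡⟨ cong (R ℕ.+_) lastColumn-raise ⟩
      R ℕ.+ (L ℕ.+ Z ℕ.+ 1)                                ≡⟨ shuffle R L Z ⟩
      suc (R ℕ.+ L ℕ.+ Z)                                  ≡⟨ cong (λ x → suc (x ℕ.+ Z)) inversionCount-raise-block ⟩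
      suc (inversionCount s ℕ.+ Z ℕ.+ Z)                   ≡⟨ cong suc (ℕₚ.+-assoc _ Z Z) ⟩
      suc (inversionCount s ℕ.+ (Z ℕ.+ Z))                 ∎
      where
      open ≡.≡-Reasoning
      R = inversionCount (raise s p M)
      L = ∑ (allFin m) aboveˡ
      Z = ∑ (allFin m) aboveʳ
      shuffle : ∀ r l z → r ℕ.+ (l ℕ.+ z ℕ.+ 1) ≡ suc (r ℕ.+ l ℕ.+ z)
      shuffle = solve-∀

  signEven-insert-fromℕ : (τ : Fin m → Fin m) → signEven (insert τ (fromℕ m)) ≡ signEven τ
  signEven-insert-fromℕ {m} τ = cong even (begin
    inversions σ
      ≡⟨ inversions≡inversionCount σ ⟩
    inversionCount (toℕ ∘ σ)
      ≡⟨ inversionCount-split (toℕ ∘ σ) ⟩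
    inversionCount (toℕ ∘ σ ∘ inject₁) ℕ.+ ∑[ i ∈ allFin m ] ⟦ toℕ (σ (fromℕ m)) ℕ.<ᵇ toℕ (σ (inject₁ i)) ⟧
      ≡⟨ cong₂ ℕ._+_ (inversionCount-cong block) (≡.trans (∑-cong (allFin m) column) (∑-ε (allFin m))) ⟩
    inversionCount (toℕ ∘ τ) ℕ.+ 0
      ≡⟨ ℕₚ.+-identityʳ _ ⟩
    inversionCount (toℕ ∘ τ)
      ≡⟨ inversions≡inversionCount τ ⟨
    inversions τ ∎)
    where
    open ≡.≡-Reasoning
    σ = insert τ (fromℕ m)
    σ-inject₁ : ∀ k → σ (inject₁ k) ≡ inject₁ (τ k)
    σ-inject₁ k = insert-inject₁ τ (fromℕ m) k (Finₚ.fromℕ≢inject₁ ∘ ≡.sym)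
    block : toℕ ∘ σ ∘ inject₁ ≗ toℕ ∘ τ
    block k = ≡.trans (cong toℕ (σ-inject₁ k)) (Finₚ.toℕ-inject₁ (τ k))
    column : ∀ i → ⟦ toℕ (σ (fromℕ m)) ℕ.<ᵇ toℕ (σ (inject₁ i)) ⟧ ≡ 0
    column i = cong ⟦_⟧ (≡.trans (cong₂ (λ a b → toℕ a ℕ.<ᵇ toℕ b) (insert-pivot τ (fromℕ m)) (σ-inject₁ i))
                                 (<ᵇ-false (ℕₚ.<⇒≤ (inject₁<fromℕ (τ i)))))

  signEven-insert-inject₁ : {τ : Fin m → Fin m} → Injective _≡_ _≡_ τ → (p : Fin m) →
                            signEven (insert τ (inject₁ p)) ≡ not (signEven τ)
  signEven-insert-inject₁ {m} {τ} τ-inj p = begin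
    even (inversions σ)
      ≡⟨ cong even (inversions≡inversionCount σ) ⟩
    even (inversionCount (toℕ ∘ σ))
      ≡⟨ cong even (inversionCount-split (toℕ ∘ σ)) ⟩
    even (inversionCount (toℕ ∘ σ ∘ inject₁) ℕ.+ ∑[ i ∈ allFin m ] ⟦ toℕ (σ (fromℕ m)) ℕ.<ᵇ toℕ (σ (inject₁ i)) ⟧)
      ≡⟨ cong even (cong₂ ℕ._+_ (inversionCount-cong block) (∑-cong (allFin m) column)) ⟩
    even (inversionCount r ℕ.+ ∑[ i ∈ allFin m ] ⟦ toℕ (τ p) ℕ.<ᵇ r i ⟧)
      ≡⟨ cong even (inversionCount-raise (toℕ ∘ τ) (τ-inj ∘ Finₚ.toℕ-injective) (Finₚ.toℕ<n ∘ τ) p) ⟩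
    even (suc (inversionCount (toℕ ∘ τ) ℕ.+ (Z ℕ.+ Z)))
      ≡⟨ ≡.trans (even-suc (inversionCount (toℕ ∘ τ) ℕ.+ (Z ℕ.+ Z)))
                 (cong not (even-+-double (inversionCount (toℕ ∘ τ)) Z)) ⟩
    not (even (inversionCount (toℕ ∘ τ)))
      ≡⟨ cong (not ∘ even) (inversions≡inversionCount τ) ⟨
    not (signEven τ) ∎
    where
    open ≡.≡-Reasoning
    σ = insert τ (inject₁ p)
    r = raise (toℕ ∘ τ) p m
    Z = ∑[ j ∈ allFin m ] ⟦ (toℕ p ℕ.<ᵇ toℕ j) ∧ (toℕ (τ p) ℕ.<ᵇ toℕ (τ j)) ⟧
    blockAt : (k : Fin m) (p≟k : Dec (p ≡ k)) → toℕ (σ (inject₁ k)) ≡ (if isYes p≟k then m else toℕ (τ k))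
    blockAt k (yes refl) = ≡.trans (cong toℕ (insert-pivot τ (inject₁ p))) (Finₚ.toℕ-fromℕ m)
    blockAt k (no p≢k)   = ≡.trans (cong toℕ (insert-inject₁ τ (inject₁ p) k (p≢k ∘ ≡.sym ∘ Finₚ.inject₁-injective)))
                                   (Finₚ.toℕ-inject₁ (τ k))
    block : toℕ ∘ σ ∘ inject₁ ≗ r
    block k = blockAt k (p ≟ k)
    column : ∀ i → ⟦ toℕ (σ (fromℕ m)) ℕ.<ᵇ toℕ (σ (inject₁ i)) ⟧ ≡ ⟦ toℕ (τ p) ℕ.<ᵇ r i ⟧
    column i = cong₂ (λ a b → ⟦ a ℕ.<ᵇ b ⟧)
      (≡.trans (cong toℕ (≡.trans (insert-fromℕ τ (inject₁ p)) (extend-inject₁ τ p))) (Finₚ.toℕ-inject₁ (τ p)))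
      (block i)

_≗ᵇ_ : (Fin m → Fin n) → (Fin m → Fin n) → Bool
_≗ᵇ_ {zero}  f g = true
_≗ᵇ_ {suc m} f g = (f zero == g zero) ∧ ((f ∘ suc) ≗ᵇ (g ∘ suc))

≗ᵇ-sound : {f g : Fin m → Fin n} → T (f ≗ᵇ g) → f ≗ g
≗ᵇ-sound {suc m} {f = f} t zero    = toWitness (proj₁ (Equivalence.to (T-∧ {f zero == _}) t))
≗ᵇ-sound {suc m} {f = f} t (suc i) = ≗ᵇ-sound (proj₂ (Equivalence.to (T-∧ {f zero == _}) t)) i

≗ᵇ-complete : {f g : Fin m → Fin n} → f ≗ g → T (f ≗ᵇ g)
≗ᵇ-complete {zero}  f≗g = _
≗ᵇ-complete {suc m} f≗g = Equivalence.from T-∧ (fromWitness (f≗g zero) , ≗ᵇ-complete (f≗g ∘ suc))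

module PermutationSum {c ℓ} (M : CommutativeMonoid c ℓ) where
  open CommutativeMonoid M renaming (refl to ≈-refl; sym to ≈-sym; trans to ≈-trans)
  open ListSum M
  open import Relation.Binary.Reasoning.Setoid setoid

  RespectsExt : {X Y : Set} → ((X → Y) → Carrier) → Set _
  RespectsExt F = ∀ {f g} → f ≗ g → F f ≈ F g

  -- allFuns builds its functions with a pattern lambda of its own, which cons below matches only
  -- pointwise; hence the appeals to F-cong.
  ∑-δ-allFuns : ∀ m n (f : Fin m → Fin n) (F : (Fin m → Fin n) → Carrier) → RespectsExt F →
                ∑[ g ∈ allFuns m n ] (if f ≗ᵇ g then F g else ε) ≈ F f
  ∑-δ-allFuns zero    n f F F-cong = ≈-trans (identityʳ _) (F-cong λ ())
  ∑-δ-allFuns (suc m) n f F F-cong = begin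
    ∑[ g ∈ allFuns (suc m) n ] (if f ≗ᵇ g then F g else ε)
      ≈⟨ ∑-concatMap _ (allFuns m n) _ ⟩
    ∑[ g ∈ allFuns m n ] ∑ (map _ (allFin n)) (λ h → if f ≗ᵇ h then F h else ε)
      ≈⟨ ∑-cong (allFuns m n) (λ g → ≈-trans (reflexive (∑-map _ (allFin n) _)) (∑-cong (allFin n) λ j →
           ≈-trans (reflexive (if-∧ (f zero == j))) (if-then-cong (f zero == j)
                   (if-then-cong ((f ∘ suc) ≗ᵇ g) (F-cong λ { zero → refl ; (suc i) → refl }))))) ⟩
    ∑[ g ∈ allFuns m n ] ∑[ j ∈ allFin n ] (if f zero == j then (if (f ∘ suc) ≗ᵇ g then F (cons j g) else ε) else ε)
      ≈⟨ ∑-cong (allFuns m n) (λ g → ∑-δ n (f zero) _) ⟩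
    ∑[ g ∈ allFuns m n ] (if (f ∘ suc) ≗ᵇ g then F (cons (f zero) g) else ε)
      ≈⟨ ∑-δ-allFuns m n (f ∘ suc) (F ∘ cons (f zero)) (F-cong ∘ cons-cong) ⟩
    F (cons (f zero) (f ∘ suc))
      ≈⟨ F-cong (λ { zero → refl ; (suc i) → refl }) ⟩
    F f ∎
    where
    cons : Fin n → (Fin m → Fin n) → Fin (suc m) → Fin n
    cons j g zero    = j
    cons j g (suc i) = g i
    cons-cong : {j : Fin n} {g h : Fin m → Fin n} → g ≗ h → cons j g ≗ cons j h
    cons-cong g≗h zero    = refl
    cons-cong g≗h (suc i) = g≗h i

  ∑-insert-δ : (σ : Fin (suc m) → Fin (suc m)) (x : Carrier) →
               ∑[ τ ∈ allFuns m m ] ∑[ p ∈ allFin (suc m) ] (if isPerm τ ∧ (insert τ p ≗ᵇ σ) then x else ε)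
               ≈ (if isPerm σ then x else ε)
  ∑-insert-δ {m} σ x with isPerm σ in σ-perm
  ... | false = ≈-trans (∑-cong (allFuns m m) λ τ → ∑-cong (allFin (suc m)) λ p → reflexive (if-cong (never τ p)))
                        (≈-trans (∑-cong (allFuns m m) λ _ → ∑-ε (allFin (suc m))) (∑-ε (allFuns m m)))
    where
    never : ∀ τ p → (isPerm τ ∧ (insert τ p ≗ᵇ σ)) ≡ false
    never τ p = T-⇔⇒≡ (λ t → let τ-perm , ins≗ᵇσ = Equivalence.to (T-∧ {isPerm τ}) t in
      ≡.subst T σ-perm (injective⇒isPerm (injective-resp-≗ (≗ᵇ-sound {f = insert τ p} {σ} ins≗ᵇσ)
                                                            (insert-injective τ p (isPerm⇒injective τ-perm)))))
      λ ()
  ... | true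
    with τ₀ , p₀ , τ₀-inj , ins≗σ ← insert-surjective (isPerm⇒injective (Equivalence.from T-≡ σ-perm)) = begin
    ∑[ τ ∈ allFuns m m ] ∑[ p ∈ allFin (suc m) ] (if isPerm τ ∧ (insert τ p ≗ᵇ σ) then x else ε)
      ≈⟨ ∑-cong (allFuns m m) (λ τ → ∑-cong (allFin (suc m)) λ p →
           reflexive (≡.trans (if-cong (decomposition τ p)) (if-∧ (τ₀ ≗ᵇ τ)))) ⟩
    ∑[ τ ∈ allFuns m m ] ∑[ p ∈ allFin (suc m) ] (if τ₀ ≗ᵇ τ then (if p₀ == p then x else ε) else ε)
      ≈⟨ ∑-cong (allFuns m m) (λ τ →
           ≈-trans (∑-if (allFin (suc m)) (τ₀ ≗ᵇ τ) _) (if-then-cong (τ₀ ≗ᵇ τ) (∑-δ (suc m) p₀ _))) ⟩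
    ∑[ τ ∈ allFuns m m ] (if τ₀ ≗ᵇ τ then x else ε)
      ≈⟨ ∑-δ-allFuns m m τ₀ (λ _ → x) (λ _ → ≈-refl) ⟩
    x ∎
    where
    decomposition : ∀ τ p → (isPerm τ ∧ (insert τ p ≗ᵇ σ)) ≡ ((τ₀ ≗ᵇ τ) ∧ (p₀ == p))
    decomposition τ p = T-⇔⇒≡
      (λ t → let _ , ins≗ᵇσ = Equivalence.to (T-∧ {isPerm τ}) t
                 τ₀≗τ , p₀≡p = insert-unique λ k →
                   ≡.trans (ins≗σ k) (≡.sym (≗ᵇ-sound {f = insert τ p} {σ} ins≗ᵇσ k))
             in  Equivalence.from T-∧ (≗ᵇ-complete τ₀≗τ , fromWitness p₀≡p))
      (λ t → let τ₀≗ᵇτ , p₀==p = Equivalence.to (T-∧ {τ₀ ≗ᵇ τ}) t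
                 τ₀≗τ = ≗ᵇ-sound {f = τ₀} {τ} τ₀≗ᵇτ
             in  Equivalence.from T-∧ (injective⇒isPerm (injective-resp-≗ τ₀≗τ τ₀-inj) , ≗ᵇ-complete λ k →
                   ≡.trans (insert-cong (≡.sym ∘ τ₀≗τ) p k)
                           (≡.trans (cong (λ q → insert τ₀ q k) (≡.sym (toWitness p₀==p))) (ins≗σ k))))

  ∑-perms-insert : (F : (Fin (suc m) → Fin (suc m)) → Carrier) → RespectsExt F →
                   ∑[ σ ∈ allFuns (suc m) (suc m) ] (if isPerm σ then F σ else ε)
                   ≈ ∑[ τ ∈ allFuns m m ] (if isPerm τ then ∑[ p ∈ allFin (suc m) ] F (insert τ p) else ε)
  ∑-perms-insert {m} F F-cong = begin
    ∑[ σ ∈ allFuns (suc m) (suc m) ] (if isPerm σ then F σ else ε)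
      ≈⟨ ∑-cong (allFuns (suc m) (suc m)) (λ σ → ∑-insert-δ σ (F σ)) ⟨
    ∑[ σ ∈ allFuns (suc m) (suc m) ] ∑[ τ ∈ allFuns m m ] ∑[ p ∈ allFin (suc m) ] G τ p σ
      ≈⟨ ∑-comm (allFuns (suc m) (suc m)) (allFuns m m) _ ⟩
    ∑[ τ ∈ allFuns m m ] ∑[ σ ∈ allFuns (suc m) (suc m) ] ∑[ p ∈ allFin (suc m) ] G τ p σ
      ≈⟨ ∑-cong (allFuns m m) (λ τ → ∑-comm (allFuns (suc m) (suc m)) (allFin (suc m)) _) ⟩
    ∑[ τ ∈ allFuns m m ] ∑[ p ∈ allFin (suc m) ] ∑[ σ ∈ allFuns (suc m) (suc m) ] G τ p σ
      ≈⟨ ∑-cong (allFuns m m) (λ τ → ∑-cong (allFin (suc m)) (λ p → collapse τ p)) ⟩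
    ∑[ τ ∈ allFuns m m ] ∑[ p ∈ allFin (suc m) ] (if isPerm τ then F (insert τ p) else ε)
      ≈⟨ ∑-cong (allFuns m m) (λ τ → ∑-if (allFin (suc m)) (isPerm τ) _) ⟩
    ∑[ τ ∈ allFuns m m ] (if isPerm τ then ∑[ p ∈ allFin (suc m) ] F (insert τ p) else ε) ∎
    where
    G : (Fin m → Fin m) → Fin (suc m) → (Fin (suc m) → Fin (suc m)) → Carrier
    G τ p σ = if isPerm τ ∧ (insert τ p ≗ᵇ σ) then F σ else ε
    collapse : ∀ τ p → ∑[ σ ∈ allFuns (suc m) (suc m) ] G τ p σ ≈ (if isPerm τ then F (insert τ p) else ε)
    collapse τ p = begin
      ∑[ σ ∈ allFuns (suc m) (suc m) ] G τ p σ
        ≈⟨ ∑-cong (allFuns (suc m) (suc m)) (λ σ → reflexive (if-∧ (isPerm τ))) ⟩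
      ∑[ σ ∈ allFuns (suc m) (suc m) ] (if isPerm τ then (if insert τ p ≗ᵇ σ then F σ else ε) else ε)
        ≈⟨ ∑-if (allFuns (suc m) (suc m)) (isPerm τ) _ ⟩
      (if isPerm τ then ∑[ σ ∈ allFuns (suc m) (suc m) ] (if insert τ p ≗ᵇ σ then F σ else ε) else ε)
        ≈⟨ if-then-cong (isPerm τ) (∑-δ-allFuns (suc m) (suc m) (insert τ p) F F-cong) ⟩
      (if isPerm τ then F (insert τ p) else ε) ∎

module SignedCycleSum {r ℓr} (R : CommutativeRing r ℓr) (c : CommutativeRing.Carrier R) where
  open CommutativeRing R renaming (refl to ≈-refl; sym to ≈-sym; trans to ≈-trans)
  open import Relation.Binary.Reasoning.Setoid setoid
  import Algebra.Properties.Ring ring as Ringₚ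
  open ListSum +-commutativeMonoid
  open PermutationSum +-commutativeMonoid
  private
    module Product = ListSum *-commutativeMonoid

  ∏ : {X : Set} → List X → (X → Carrier) → Carrier
  ∏ = Product.∑

  syntax ∏ xs (λ x → e) = ∏[ x ∈ xs ] e

  cycleWeight : (Fin m → Fin m) → Carrier
  cycleWeight {m} σ = ∏[ i ∈ allFin m ] (if isLeader σ i then c else 1#)

  signed : Bool → Carrier → Carrier
  signed b x = if b then x else - x

  weight : (Fin m → Fin m) → Carrier
  weight σ = signed (signEven σ) (cycleWeight σ)

  signedCycleSum : ℕ → Carrier
  signedCycleSum m = ∑[ σ ∈ allFuns m m ] (if isPerm σ then weight σ else 0#)

  fallingFactorial : ℕ → Carrier
  fallingFactorial zero    = 1#
  fallingFactorial (suc m) = (c - natCast R m) * fallingFactorial m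

  signed-cong : ∀ b {x y} → x ≈ y → signed b x ≈ signed b y
  signed-cong true  x≈y = x≈y
  signed-cong false x≈y = -‿cong x≈y

  signed-*ˡ : ∀ b k x → signed b (k * x) ≈ k * signed b x
  signed-*ˡ true  k x = ≈-refl
  signed-*ˡ false k x = Ringₚ.-‿distribʳ-* k x

  signed-not : ∀ b x → signed (not b) x ≈ - signed b x
  signed-not true  x = ≈-refl
  signed-not false x = ≈-sym (Ringₚ.-‿involutive x)

  weight-resp-≗ : RespectsExt (weight {m})
  weight-resp-≗ {m} {σ} {σ′} σ≗σ′ = ≈-trans (reflexive (cong (λ b → signed b (cycleWeight σ)) signEven≡))
                                            (signed-cong (signEven σ′) cycleWeight≈)
    where
    signEven≡ : signEven σ ≡ signEven σ′
    signEven≡ = cong even (≡.trans (inversions≡inversionCount σ)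
                          (≡.trans (inversionCount-cong (cong toℕ ∘ σ≗σ′)) (≡.sym (inversions≡inversionCount σ′))))
    cycleWeight≈ : cycleWeight σ ≈ cycleWeight σ′
    cycleWeight≈ = Product.∑-cong (allFin m) λ i → reflexive (if-cong (isLeader-resp-≗ σ≗σ′ i))

  cycleWeight-insert : (τ : Fin m → Fin m) (p : Fin (suc m)) →
                       cycleWeight (insert τ p) ≈ cycleWeight τ * (if isLeader (insert τ p) (fromℕ m) then c else 1#)
  cycleWeight-insert {m} τ p = ≈-trans (Product.∑-allFin-inject₁ m _)
    (*-congʳ (Product.∑-cong (allFin m) λ i → reflexive (if-cong (isLeader-insert-inject₁ τ p i))))

  weight-insert-fromℕ : (τ : Fin m → Fin m) → weight (insert τ (fromℕ m)) ≈ c * weight τ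
  weight-insert-fromℕ {m} τ = begin
    signed (signEven σ) (cycleWeight σ)
      ≡⟨ cong (λ b → signed b (cycleWeight σ)) (signEven-insert-fromℕ τ) ⟩
    signed (signEven τ) (cycleWeight σ)
      ≈⟨ signed-cong (signEven τ) (cycleWeight-insert τ (fromℕ m)) ⟩
    signed (signEven τ) (cycleWeight τ * (if isLeader σ (fromℕ m) then c else 1#))
      ≡⟨ cong (λ x → signed (signEven τ) (cycleWeight τ * x)) (if-cong (isLeader-insert-fromℕ τ)) ⟩
    signed (signEven τ) (cycleWeight τ * c)
      ≈⟨ signed-cong (signEven τ) (*-comm _ c) ⟩
    signed (signEven τ) (c * cycleWeight τ)
      ≈⟨ signed-*ˡ (signEven τ) c (cycleWeight τ) ⟩
    c * signed (signEven τ) (cycleWeight τ) ∎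
    where σ = insert τ (fromℕ m)

  weight-insert-inject₁ : {τ : Fin m → Fin m} → Injective _≡_ _≡_ τ → (p : Fin m) →
                          weight (insert τ (inject₁ p)) ≈ - weight τ
  weight-insert-inject₁ {m} {τ} τ-inj p = begin
    signed (signEven σ) (cycleWeight σ)
      ≡⟨ cong (λ b → signed b (cycleWeight σ)) (signEven-insert-inject₁ τ-inj p) ⟩
    signed (not (signEven τ)) (cycleWeight σ)
      ≈⟨ signed-cong (not (signEven τ)) (cycleWeight-insert τ (inject₁ p)) ⟩
    signed (not (signEven τ)) (cycleWeight τ * (if isLeader σ (fromℕ m) then c else 1#))
      ≡⟨ cong (λ x → signed (not (signEven τ)) (cycleWeight τ * x)) (if-cong (isLeader-insert-inject₁-fromℕ τ p)) ⟩
    signed (not (signEven τ)) (cycleWeight τ * 1#)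
      ≈⟨ signed-cong (not (signEven τ)) (*-identityʳ _) ⟩
    signed (not (signEven τ)) (cycleWeight τ)
      ≈⟨ signed-not (signEven τ) (cycleWeight τ) ⟩
    - signed (signEven τ) (cycleWeight τ) ∎
    where σ = insert τ (inject₁ p)

  ∑-const : ∀ m y → ∑[ _ ∈ allFin m ] y ≈ natCast R m * y
  ∑-const zero    y = ≈-sym (zeroˡ y)
  ∑-const (suc m) y = begin
    ∑[ _ ∈ allFin (suc m) ] y   ≈⟨ ∑-allFin-suc m _ ⟩
    y + ∑[ _ ∈ allFin m ] y     ≈⟨ +-cong (≈-sym (*-identityˡ y)) (∑-const m y) ⟩
    1# * y + natCast R m * y    ≈⟨ distribʳ y 1# (natCast R m) ⟨
    natCast R (suc m) * y       ∎

  ∑-*ˡ : {X : Set} (xs : List X) (k : Carrier) (h : X → Carrier) → ∑[ x ∈ xs ] (k * h x) ≈ k * ∑ xs h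
  ∑-*ˡ []       k h = ≈-sym (zeroʳ k)
  ∑-*ˡ (x ∷ xs) k h = ≈-trans (+-congˡ (∑-*ˡ xs k h)) (≈-sym (distribˡ k (h x) (∑ xs h)))

  ∑-weight-insert : {τ : Fin m → Fin m} → Injective _≡_ _≡_ τ →
                    ∑[ p ∈ allFin (suc m) ] weight (insert τ p) ≈ (c - natCast R m) * weight τ
  ∑-weight-insert {m} {τ} τ-inj = begin
    ∑[ p ∈ allFin (suc m) ] weight (insert τ p)
      ≈⟨ ∑-allFin-inject₁ m _ ⟩
    ∑[ p ∈ allFin m ] weight (insert τ (inject₁ p)) + weight (insert τ (fromℕ m))
      ≈⟨ +-cong (∑-cong (allFin m) (weight-insert-inject₁ τ-inj)) (weight-insert-fromℕ τ) ⟩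
    ∑[ _ ∈ allFin m ] (- w) + c * w
      ≈⟨ +-congʳ (≈-trans (∑-const m (- w)) (≈-trans (≈-sym (Ringₚ.-‿distribʳ-* k w))
                                                    (Ringₚ.-‿distribˡ-* k w))) ⟩
    (- k) * w + c * w
      ≈⟨ +-comm _ _ ⟩
    c * w + (- k) * w
      ≈⟨ distribʳ w c (- k) ⟨
    (c - k) * w ∎
    where
    k = natCast R m
    w = weight τ

  signedCycleSum-suc : ∀ m → signedCycleSum (suc m) ≈ (c - natCast R m) * signedCycleSum m
  signedCycleSum-suc m = begin
    ∑[ σ ∈ allFuns (suc m) (suc m) ] (if isPerm σ then weight σ else 0#)
      ≈⟨ ∑-perms-insert {m} weight weight-resp-≗ ⟩
    ∑[ τ ∈ allFuns m m ] (if isPerm τ then ∑[ p ∈ allFin (suc m) ] weight (insert τ p) else 0#)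
      ≈⟨ ∑-cong (allFuns m m) extend-by-one ⟩
    ∑[ τ ∈ allFuns m m ] ((c - natCast R m) * (if isPerm τ then weight τ else 0#))
      ≈⟨ ∑-*ˡ (allFuns m m) (c - natCast R m) _ ⟩
    (c - natCast R m) * signedCycleSum m ∎
    where
    extend-by-one : ∀ τ → (if isPerm τ then ∑[ p ∈ allFin (suc m) ] weight (insert τ p) else 0#)
                          ≈ (c - natCast R m) * (if isPerm τ then weight τ else 0#)
    extend-by-one τ with isPerm τ in τ-perm
    ... | true  = ∑-weight-insert (isPerm⇒injective {σ = τ} (Equivalence.from T-≡ τ-perm))
    ... | false = ≈-sym (zeroʳ _)

  signedCycleSum≈fallingFactorial : ∀ m → signedCycleSum m ≈ fallingFactorial m
  signedCycleSum≈fallingFactorial zero    = +-identityʳ 1#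
  signedCycleSum≈fallingFactorial (suc m) = ≈-trans (signedCycleSum-suc m) (*-congˡ (signedCycleSum≈fallingFactorial m))

  fallingFactorial-root : IsIntegralDomain R → ∀ n → fallingFactorial (suc n) ≈ 0# →
                          ∃ λ k → k ℕ.≤ n × c ≈ natCast R k
  fallingFactorial-root domain n ff≈0 with IsIntegralDomain.noZeroDivisors domain (c - natCast R n) (fallingFactorial n) ff≈0
  ... | inj₁ c-n≈0 = n , ℕₚ.≤-refl , Ringₚ.x∙y⁻¹≈ε⇒x≈y c (natCast R n) c-n≈0
  ... | inj₂ ffn≈0 = earlier n ffn≈0
    where
    earlier : ∀ n → fallingFactorial n ≈ 0# → ∃ λ k → k ℕ.≤ n × c ≈ natCast R k
    earlier zero    1≈0   = contradiction 1≈0 (IsIntegralDomain.nontrivial domain)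
    earlier (suc n) ff≈0′ with k , k≤n , c≈k ← fallingFactorial-root domain n ff≈0′ =
      k , ℕₚ.m≤n⇒m≤1+n k≤n , c≈k

module _ {k ℓ a ℓa b ℓb} {K : CommutativeRing k ℓ} (A : Algebra K a ℓa) (B : Algebra K b ℓb)
         {f : Algebra.Carrier A → Algebra.Carrier B} (f-linear : IsLinear A B f) where
  private
    module A = Algebra A
    module B = Algebra B
  open B using (_≈_; _*_; 1#) renaming (refl to ≈-refl; sym to ≈-sym; trans to ≈-trans)
  open SignedCycleSum B.ringA (f A.1#)
  open ListSum B.+-commutativeMonoid

  fPerm-ones≈cycleWeight : (σ : Fin m → Fin m) → fPerm A B f σ (λ _ → A.1#) ≈ cycleWeight σ
  fPerm-ones≈cycleWeight {m} σ = go (allFin m)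
    where
    product-of-ones : (P : Fin m → Bool) (xs : List (Fin m)) →
                      foldr (λ j r → if P j then A.1# A.* r else r) A.1# xs A.≈ A.1#
    product-of-ones P []       = A.refl
    product-of-ones P (x ∷ xs) with P x
    ... | true  = A.trans (A.*-identityˡ _) (product-of-ones P xs)
    ... | false = product-of-ones P xs
    go : ∀ xs → foldr (λ i r → if isLeader σ i then fCycle A B f σ i (λ _ → A.1#) * r else r) 1# xs
                ≈ ∏[ i ∈ xs ] (if isLeader σ i then f A.1# else 1#)
    go []       = ≈-refl
    go (x ∷ xs) with isLeader σ x
    ... | true  = B.*-cong (IsLinear.cong f-linear (product-of-ones (inCycle σ x) (allFin m))) (go xs)
    ... | false = ≈-trans (go xs) (≈-sym (B.*-identityˡ _))

  Φ-ones≈signedCycleSum : ∀ m → Φ A B m f (λ _ → A.1#) ≈ signedCycleSum m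
  Φ-ones≈signedCycleSum m = ≈-trans (∑-filter isPerm (allFuns m m) _) (∑-cong (allFuns m m) λ σ →
    if-then-cong (isPerm σ) (signed-cong (signEven σ) (fPerm-ones≈cycleWeight σ)))

corollary2p5 : ∀ {c ℓ c₁ ℓ₁ c₂ ℓ₂}
    (K : CommutativeRing c ℓ) → IsField K → CharZero K →
    (A : Algebra K c₁ ℓ₁) (B : Algebra K c₂ ℓ₂) →
    IsIntegralDomain (Algebra.ringA B) →
    (f : Algebra.Carrier A → Algebra.Carrier B) → IsLinear A B f →
    (n : ℕ) →
    (∀ (a : Fin (suc n) → Algebra.Carrier A) →
       Algebra._≈_ B (Φ A B (suc n) f a) (Algebra.0# B)) →
    Σ ℕ λ k → (k ≤ n) ×
      Algebra._≈_ B (f (Algebra.1# A)) (natCast (Algebra.ringA B) k)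
corollary2p5 K _ _ A B B-domain f f-linear n Φ≈0 = fallingFactorial-root B-domain n (begin
  fallingFactorial (suc n)          ≈⟨ signedCycleSum≈fallingFactorial (suc n) ⟨
  signedCycleSum (suc n)            ≈⟨ Φ-ones≈signedCycleSum A B f-linear (suc n) ⟨
  Φ A B (suc n) f (λ _ → A.1#)      ≈⟨ Φ≈0 (λ _ → A.1#) ⟩
  B.0#                              ∎)
  where
  module A = Algebra A
  module B = Algebra B
  open SignedCycleSum B.ringA (f A.1#)
  open import Relation.Binary.Reasoning.Setoid B.setoid
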